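{- For $n,m\geq 1$, $|\hat{\mathcal{B}}_{n,m}(112)|=S(n-1,n-m)$, where $S(\cdot,\cdot)$ denotes the Stirling numbers of the second kind. Consequently $|\hat{\mathcal{B}}_n(112)|$ equals the $(n-1)$-th Bell number.
   Context: An endofunction of size $n$ is a word $x=x_1\cdots x_n$ with entries in $\{1,\dots,n\}$; it is a Cayley permutation if it contains every integer between $1$ and $\max(x)$. Let $\mathrm{Ascbot}(x)=\{1\}\cup\{i:1\leq i\leq n-1,\ x_i<x_{i+1}\}$ and $\mathrm{Nub}(x)$ the set of indices $i$ such that $x_i$ is the leftmost occurrence of its value. A revised ascent sequence of length $n$ is a Cayley permutation $x$ of length $n$ with $\mathrm{Ascbot}(x)=\mathrm{Nub}(x)$. For Cayley permutations $x$ and $\sigma=\sigma_1\cdots\sigma_k$, $x$ contains $\sigma$ if there are indices $i_1<\cdots<i_k$ such that for all $s,t$: $x_{i_s}<x_{i_t}\iff\sigma_s<\sigma_t$ and $x_{i_s}=x_{i_t}\iff\sigma_s=\sigma_t$; otherwise $x$ avoids $\sigma$. $\hat{\mathcal{B}}_n(\sigma)$ is the set of revised ascent sequences of length $n$ avoiding $\sigma$, and $\hat{\mathcal{B}}_{n,m}(112)$ is the set of those $x\in\hat{\mathcal{B}}_n(112)$ with $\max(x)=m$. $S(n,k)$ is the number of partitions of $[n]$ into $k$ blocks (with $S(0,0)=1$), and the $n$-th Bell number is the number of set partitions of $[n]$. -}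

module Defs where

open import Data.Nat using (ℕ; zero; suc; _+_; _*_; _∸_; _<ᵇ_; _≡ᵇ_)
open import Data.Bool using (Bool; true; false; _∧_; _∨_; not; if_then_else_)
open import Data.List using (List; []; _∷_; map; concatMap; filter; length; foldr; upTo; zip; drop)
open import Data.Bool.ListAction using (all; any)
open import Data.Nat.ListAction using (sum)
open import Data.List.Membership.DecPropositional using ()
open import Relation.Binary.PropositionalEquality using (_≡_)
open import Relation.Nullary.Decidable using (Dec; yes; no)
import Data.Bool as B

-- Words are lists of naturals; positions are 1-based in the paper,
-- 0-based here (position i here = position i+1 in the paper).

wordsOver : ℕ → ℕ → List (List ℕ)
wordsOver n zero = [] ∷ []
wordsOver n (suc k) = concatMap (λ a → map (a ∷_) (wordsOver n k)) (map suc (upTo n))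

Endo : ℕ → List (List ℕ)
Endo n = wordsOver n n

maxW : List ℕ → ℕ
maxW = foldr Data.Nat._⊔_ 0

elemᵇ : ℕ → List ℕ → Bool
elemᵇ a xs = any (λ b → a ≡ᵇ b) xs

isCayley : List ℕ → Bool
isCayley x = all (λ v → elemᵇ (suc v) x) (upTo (maxW x))

-- i-th entry (0-based), default 0
at : List ℕ → ℕ → ℕ
at [] i = 0
at (a ∷ xs) zero = a
at (a ∷ xs) (suc i) = at xs i

take' : ℕ → List ℕ → List ℕ
take' zero xs = []
take' (suc k) [] = []
take' (suc k) (a ∷ xs) = a ∷ take' k xs

eqB : Bool → Bool → Bool
eqB true b = b
eqB false b = not b

inAscbot : List ℕ → ℕ → Bool
inAscbot x zero = true
inAscbot x (suc i) = (suc (suc i) <ᵇ suc (length x)) ∧ (at x (suc i) <ᵇ at x (suc (suc i)))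

inNub : List ℕ → ℕ → Bool
inNub x i = not (elemᵇ (at x i) (take' i x))

ascbotEqNub : List ℕ → Bool
ascbotEqNub x = all (λ i → eqB (inAscbot x i) (inNub x i)) (upTo (length x))

isRevAsc : List ℕ → Bool
isRevAsc x = isCayley x ∧ ascbotEqNub x

subseqs : List ℕ → List (List ℕ)
subseqs [] = [] ∷ []
subseqs (a ∷ xs) = map (a ∷_) (subseqs xs) Data.List.++ subseqs xs

cmp : ℕ → ℕ → ℕ
cmp a b = if a <ᵇ b then 0 else (if a ≡ᵇ b then 1 else 2)

orderIso : List ℕ → List ℕ → Bool
orderIso y σ = (length y ≡ᵇ length σ) ∧
  all (λ s → all (λ t → cmp (at y s) (at y t) ≡ᵇ cmp (at σ s) (at σ t))
                 (upTo (length σ)))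
      (upTo (length σ))

contains : List ℕ → List ℕ → Bool
contains x σ = any (λ y → orderIso y σ) (subseqs x)

avoids : List ℕ → List ℕ → Bool
avoids x σ = not (contains x σ)

-- \hat B_n(σ): revised ascent sequences of length n avoiding σ
-- (every revised ascent sequence is an endofunction, so we filter Endo n)
Bhat : ℕ → List ℕ → List (List ℕ)
Bhat n σ = filter (λ x → isRevAsc x ∧ avoids x σ B.≟ true) (Endo n)

Bhat112 : ℕ → ℕ → List (List ℕ)
Bhat112 n m = filter (λ x → maxW x Data.Nat.≟ m) (Bhat n (1 ∷ 1 ∷ 2 ∷ []))

S : ℕ → ℕ → ℕ
S zero zero = 1
S zero (suc k) = 0
S (suc n) zero = 0
S (suc n) (suc k) = suc k * S n (suc k) + S n k

Bell : ℕ → ℕ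
Bell n = sum (map (S n) (upTo (suc n)))

open import Data.Integer using (ℤ; +_; -[1+_])
Sℤ : ℕ → ℤ → ℕ
Sℤ n (+ k) = S n k
Sℤ n -[1+ k ] = 0

-- Cut a 112-avoiding revised ascent sequence x of length n+1 ≥ 2 and maximum m+1 at its last 1.
-- If x ends in 1, dropping that 1 leaves such a sequence of length n and maximum m+1.  Otherwise
-- the 1 is followed by some b ≥ 2.  Then it is the only 1 (another one would give 1 1 b), it is not
-- the first entry (the entries after it would all be new maxima, impossible for the last one), and
-- unless it is the second entry, the entry e before it is ≥ b (otherwise e is no ascent bottom,
-- hence a repeated value, and e e b is a 112).  Dropping the 1 and lowering the other entries by one
-- leaves such a sequence of length n and maximum m, and conversely a 1 fits back at exactly n − m
-- gaps.  So the counts c(n, m) obey c(n+1, m+1) = c(n, m+1) + (n − m) c(n, m), the recurrence of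
-- S(n−1, n−m), and summing over m gives the Bell number.
{-# OPTIONS --safe #-}
module Submission where

open import Defs
open import Algebra.Properties.CommutativeSemigroup using (interchange)
import Data.Bool as Bool
open import Data.Bool using (Bool; true; false; _∧_; _∨_; not; if_then_else_; T)
open import Data.Bool.Properties
  using (∧-assoc; ∨-assoc; ∧-zeroʳ; ∨-zeroʳ; ∨-identityʳ; ∧-identityʳ; not-involutive; ∧-distribˡ-∨;
         ∧-conicalˡ; ∧-conicalʳ; T-≡)
open import Data.Bool.ListAction using (all; any; and; or)
open import Data.Empty using (⊥-elim)
open import Data.Integer using (+_; -_; _-_; _⊖_)
open import Data.Integer.Properties using ([+m]-[+n]≡m⊖n; ⊖-≥; ⊖-<)
open import Data.List
  using (List; []; _∷_; [_]; _++_; _∷ʳ_; length; map; concatMap; filter; upTo; cartesianProductWith)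
open import Data.List.Membership.Propositional using (_∈_; find; lose)
open import Data.List.Membership.Propositional.Properties
  using (∈-map⁺; ∈-map⁻; ∈-++⁺ˡ; ∈-++⁺ʳ; ∈-++⁻; ∈-upTo⁺; ∈-upTo⁻; ∈-filter⁺; ∈-filter⁻;
         ∈-concatMap⁺; ∈-concatMap⁻; ∈-cartesianProductWith⁺; ∈-cartesianProductWith⁻)
open import Data.List.Membership.Propositional.Properties.WithK using (unique∧set⇒bag)
open import Data.List.Properties
  using (++-assoc; ++-identityʳ; ++-conicalʳ; map-applyUpTo; map-cong; map-cong-local; map-∘; map-++; map-injective;
         ∷-injective; ∷-injectiveˡ; ∷-injectiveʳ; ∷ʳ-injectiveˡ; length-map; length-++; upTo-∷ʳ)
open import Data.List.Relation.Binary.BagAndSetEquality using (∼bag⇒↭)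
open import Data.List.Relation.Binary.Permutation.Propositional.Properties using (↭-length)
open import Data.List.Relation.Unary.All as All using (All; []; _∷_)
open import Data.List.Relation.Unary.All.Properties as AllP using (applyUpTo⁺₁)
open import Data.List.Relation.Unary.AllPairs using ([]; _∷_)
open import Data.List.Relation.Unary.Any using (here; there)
import Data.List.Relation.Unary.Any.Properties as Any
open import Data.List.Relation.Unary.Any.Properties using (any⁺)
open import Data.List.Relation.Unary.Unique.Propositional using (Unique)
import Data.List.Relation.Unary.Unique.Propositional.Properties as Unique
open import Data.Nat
  using (ℕ; zero; suc; pred; _+_; _*_; _∸_; _⊔_; _≤_; _<_; _≥_; z≤n; s≤s; _<ᵇ_; _≡ᵇ_; _≤ᵇ_; _≟_; _≤?_)
open import Data.Nat.ListAction using (sum)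
open import Data.Nat.ListAction.Properties using (sum-++)
open import Data.Nat.Properties
open import Data.Product using (_×_; _,_; proj₁; proj₂; ∃; ∃₂)
open import Data.Sum using (inj₁; inj₂)
open import Function using (_∘_; id; Equivalence; mk⇔)
open import Relation.Binary.PropositionalEquality
  using (_≡_; _≢_; refl; sym; trans; cong; cong₂; subst; module ≡-Reasoning)
open import Relation.Nullary using (¬_; yes; no)

T⇒≡true : ∀ {b} → T b → b ≡ true
T⇒≡true = Equivalence.to T-≡

≡true⇒T : ∀ {b} → b ≡ true → T b
≡true⇒T = Equivalence.from T-≡

≡ᵇ-refl : ∀ n → (n ≡ᵇ n) ≡ true
≡ᵇ-refl n = T⇒≡true (≡⇒≡ᵇ n n refl)

≢⇒≡ᵇ-false : ∀ {m n} → m ≢ n → (m ≡ᵇ n) ≡ false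
≢⇒≡ᵇ-false {m} {n} m≢n with m ≡ᵇ n in eq
... | true = ⊥-elim (m≢n (≡ᵇ⇒≡ m n (≡true⇒T eq)))
... | false = refl

≤⇒<ᵇ-false : ∀ {m n} → n ≤ m → (m <ᵇ n) ≡ false
≤⇒<ᵇ-false {m} {n} n≤m with m <ᵇ n in eq
... | true = ⊥-elim (<⇒≱ (<ᵇ⇒< m n (≡true⇒T eq)) n≤m)
... | false = refl

2≤⇒1≤ : ∀ {c} → 2 ≤ c → 1 ≤ c
2≤⇒1≤ (s≤s _) = s≤s z≤n

map-upTo-suc : ∀ {A : Set} (f : ℕ → A) n → map f (upTo (suc n)) ≡ f 0 ∷ map (f ∘ suc) (upTo n)
map-upTo-suc f n = cong (f 0 ∷_) (trans (map-applyUpTo suc f n) (sym (map-applyUpTo id (f ∘ suc) n)))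

map-cong-upTo : ∀ {A : Set} {f g : ℕ → A} n → (∀ {i} → i < n → f i ≡ g i) → map f (upTo n) ≡ map g (upTo n)
map-cong-upTo n f≡g = map-cong-local (applyUpTo⁺₁ id n f≡g)

any-++ : ∀ {A : Set} (p : A → Bool) xs ys → any p (xs ++ ys) ≡ any p xs ∨ any p ys
any-++ p [] ys = refl
any-++ p (x ∷ xs) ys = trans (cong (p x ∨_) (any-++ p xs ys)) (sym (∨-assoc (p x) _ _))

any-map : ∀ {A B : Set} (p : B → Bool) (f : A → B) xs → any p (map f xs) ≡ any (p ∘ f) xs
any-map p f xs = cong or (sym (map-∘ xs))

any-cong : ∀ {A : Set} {p q : A → Bool} → (∀ x → p x ≡ q x) → ∀ xs → any p xs ≡ any q xs
any-cong p≡q xs = cong or (map-cong p≡q xs)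

-- Ascbot = Nub and 112-containment as recursive tests

-- ascbotNubAfter seen xs checks the Ascbot = Nub condition at the entries of xs, knowing the
-- entries seen before them.  Since `at [] 0 = 0`, the last entry is never an ascent bottom.
ascbotNubAfter : List ℕ → List ℕ → Bool
ascbotNubAfter seen [] = true
ascbotNubAfter seen (b ∷ xs) = eqB (b <ᵇ at xs 0) (not (elemᵇ b seen)) ∧ ascbotNubAfter (seen ∷ʳ b) xs

ascbotNub : List ℕ → Bool
ascbotNub [] = true
ascbotNub (a ∷ xs) = ascbotNubAfter [ a ] xs

ascbotNubAt : List ℕ → List ℕ → ℕ → Bool
ascbotNubAt seen xs j = eqB (at xs j <ᵇ at xs (suc j)) (not (elemᵇ (at xs j) (seen ++ take' j xs)))

all-ascbotNubAt : ∀ seen xs → all (ascbotNubAt seen xs) (upTo (length xs)) ≡ ascbotNubAfter seen xs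
all-ascbotNubAt seen [] = refl
all-ascbotNubAt seen (b ∷ xs) =
  trans (cong and (map-upTo-suc (ascbotNubAt seen (b ∷ xs)) (length xs)))
        (cong₂ _∧_ (cong (λ s → eqB (b <ᵇ at xs 0) (not (elemᵇ b s))) (++-identityʳ seen))
                   (trans (cong and (map-cong seen-grows (upTo (length xs)))) (all-ascbotNubAt (seen ∷ʳ b) xs)))
  where
  seen-grows : ∀ j → ascbotNubAt seen (b ∷ xs) (suc j) ≡ ascbotNubAt (seen ∷ʳ b) xs j
  seen-grows j = cong (λ s → eqB (at xs j <ᵇ at xs (suc j)) (not (elemᵇ (at xs j) s)))
                      (sym (++-assoc seen [ b ] (take' j xs)))

ascbotEqNub≡ascbotNub : ∀ x → ascbotEqNub x ≡ ascbotNub x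
ascbotEqNub≡ascbotNub [] = refl
ascbotEqNub≡ascbotNub x@(a ∷ xs) =
  trans (cong and (map-upTo-suc (λ i → eqB (inAscbot x i) (inNub x i)) (length xs)))
        (trans (cong and (map-cong-upTo (length xs) inner-index))
               (all-ascbotNubAt [ a ] xs))
  where
  inner-index : ∀ {j} → j < length xs → eqB (inAscbot x (suc j)) (inNub x (suc j)) ≡ ascbotNubAt [ a ] xs j
  inner-index {j} j<n = cong (λ t → eqB (t ∧ (at xs j <ᵇ at xs (suc j))) (inNub x (suc j))) (T⇒≡true (<⇒<ᵇ j<n))

σ112 : List ℕ
σ112 = 1 ∷ 1 ∷ 2 ∷ []

anyAbove : ℕ → List ℕ → Bool
anyAbove a = any (a <ᵇ_)

repeatThenAbove : ℕ → List ℕ → Bool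
repeatThenAbove a [] = false
repeatThenAbove a (b ∷ xs) = ((a ≡ᵇ b) ∧ anyAbove a xs) ∨ repeatThenAbove a xs

has112 : List ℕ → Bool
has112 [] = false
has112 (a ∷ xs) = repeatThenAbove a xs ∨ has112 xs

is112 : List ℕ → Bool
is112 (a ∷ b ∷ c ∷ []) = (a ≡ᵇ b) ∧ (a <ᵇ c)
is112 _ = false

cmp≡ᵇ0 : ∀ u v → (cmp u v ≡ᵇ 0) ≡ (u <ᵇ v)
cmp≡ᵇ0 zero zero = refl
cmp≡ᵇ0 zero (suc v) = refl
cmp≡ᵇ0 (suc u) zero = refl
cmp≡ᵇ0 (suc u) (suc v) = cmp≡ᵇ0 u v

cmp≡ᵇ1 : ∀ u v → (cmp u v ≡ᵇ 1) ≡ (u ≡ᵇ v)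
cmp≡ᵇ1 zero zero = refl
cmp≡ᵇ1 zero (suc v) = refl
cmp≡ᵇ1 (suc u) zero = refl
cmp≡ᵇ1 (suc u) (suc v) = cmp≡ᵇ1 u v

cmp≡ᵇ2 : ∀ u v → (cmp u v ≡ᵇ 2) ≡ (v <ᵇ u)
cmp≡ᵇ2 zero zero = refl
cmp≡ᵇ2 zero (suc v) = refl
cmp≡ᵇ2 (suc u) zero = refl
cmp≡ᵇ2 (suc u) (suc v) = cmp≡ᵇ2 u v

orderIso-σ112 : ∀ y → orderIso y σ112 ≡ is112 y
orderIso-σ112 [] = refl
orderIso-σ112 (a ∷ []) = refl
orderIso-σ112 (a ∷ b ∷ []) = refl
orderIso-σ112 (a ∷ b ∷ c ∷ d ∷ y) = refl
orderIso-σ112 (a ∷ b ∷ c ∷ [])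
  rewrite cmp≡ᵇ1 a a | cmp≡ᵇ1 a b | cmp≡ᵇ0 a c | cmp≡ᵇ1 b a | cmp≡ᵇ1 b b | cmp≡ᵇ0 b c
        | cmp≡ᵇ2 c a | cmp≡ᵇ2 c b | cmp≡ᵇ1 c c | ≡ᵇ-refl a | ≡ᵇ-refl b | ≡ᵇ-refl c
  with a ≟ b
... | no a≢b rewrite ≢⇒≡ᵇ-false a≢b = refl
... | yes refl rewrite ≡ᵇ-refl a with a <ᵇ c
...   | true = refl
...   | false = refl

any-subseqs-∷ : ∀ (p : List ℕ → Bool) a xs →
  any p (subseqs (a ∷ xs)) ≡ any (p ∘ (a ∷_)) (subseqs xs) ∨ any p (subseqs xs)
any-subseqs-∷ p a xs =
  trans (any-++ p (map (a ∷_) (subseqs xs)) (subseqs xs)) (cong (_∨ _) (any-map p (a ∷_) (subseqs xs)))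

any-subseqs-only[] : ∀ (p : List ℕ → Bool) → (∀ c ys → p (c ∷ ys) ≡ false) → ∀ xs → any p (subseqs xs) ≡ p []
any-subseqs-only[] p p∷≡false [] = ∨-identityʳ (p [])
any-subseqs-only[] p p∷≡false (a ∷ xs) =
  trans (any-subseqs-∷ p a xs)
        (cong₂ _∨_ (trans (any-subseqs-only[] (p ∘ (a ∷_)) (λ c ys → p∷≡false a (c ∷ ys)) xs) (p∷≡false a []))
                   (any-subseqs-only[] p p∷≡false xs))

any-subseqs-is112-∷∷ : ∀ a b xs → any (λ y → is112 (a ∷ b ∷ y)) (subseqs xs) ≡ (a ≡ᵇ b) ∧ anyAbove a xs
any-subseqs-is112-∷∷ a b [] = sym (∧-zeroʳ (a ≡ᵇ b))
any-subseqs-is112-∷∷ a b (c ∷ xs) =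
  trans (any-subseqs-∷ (λ y → is112 (a ∷ b ∷ y)) c xs)
        (trans (cong₂ _∨_ (any-subseqs-only[] (λ y → is112 (a ∷ b ∷ c ∷ y)) (λ _ _ → refl) xs)
                          (any-subseqs-is112-∷∷ a b xs))
               (sym (∧-distribˡ-∨ (a ≡ᵇ b) (a <ᵇ c) (anyAbove a xs))))

any-subseqs-is112-∷ : ∀ a xs → any (λ y → is112 (a ∷ y)) (subseqs xs) ≡ repeatThenAbove a xs
any-subseqs-is112-∷ a [] = refl
any-subseqs-is112-∷ a (b ∷ xs) =
  trans (any-subseqs-∷ (λ y → is112 (a ∷ y)) b xs)
        (cong₂ _∨_ (any-subseqs-is112-∷∷ a b xs) (any-subseqs-is112-∷ a xs))

any-subseqs-is112 : ∀ xs → any is112 (subseqs xs) ≡ has112 xs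
any-subseqs-is112 [] = refl
any-subseqs-is112 (a ∷ xs) =
  trans (any-subseqs-∷ is112 a xs) (cong₂ _∨_ (any-subseqs-is112-∷ a xs) (any-subseqs-is112 xs))

contains-σ112≡has112 : ∀ x → contains x σ112 ≡ has112 x
contains-σ112≡has112 x = trans (any-cong orderIso-σ112 (subseqs x)) (any-subseqs-is112 x)

concatMap-map≡cartesianProductWith : ∀ {A B C : Set} (f : A → B → C) xs ys →
  concatMap (λ x → map (f x) ys) xs ≡ cartesianProductWith f xs ys
concatMap-map≡cartesianProductWith f [] ys = refl
concatMap-map≡cartesianProductWith f (x ∷ xs) ys = cong (map (f x) ys ++_) (concatMap-map≡cartesianProductWith f xs ys)

wordsOver-suc : ∀ n k → wordsOver n (suc k) ≡ cartesianProductWith _∷_ (map suc (upTo n)) (wordsOver n k)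
wordsOver-suc n k = concatMap-map≡cartesianProductWith _∷_ (map suc (upTo n)) (wordsOver n k)

InRange : ℕ → ℕ → Set
InRange n a = 1 ≤ a × a ≤ n

∈-wordsOver⁻ : ∀ n k {x} → x ∈ wordsOver n k → length x ≡ k × All (InRange n) x
∈-wordsOver⁻ n zero (here refl) = refl , []
∈-wordsOver⁻ n (suc k) x∈
  with a , w , a∈ , w∈ , refl ← ∈-cartesianProductWith⁻ _∷_ (map suc (upTo n)) (wordsOver n k)
                                  (subst (_ ∈_) (wordsOver-suc n k) x∈)
  with a′ , a′∈ , refl ← ∈-map⁻ suc a∈
  with length≡ , inRange ← ∈-wordsOver⁻ n k w∈
  = cong suc length≡ , (s≤s z≤n , ∈-upTo⁻ a′∈) ∷ inRange

∈-wordsOver⁺ : ∀ n {x} → All (InRange n) x → x ∈ wordsOver n (length x)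
∈-wordsOver⁺ n [] = here refl
∈-wordsOver⁺ n {suc a ∷ x} ((_ , a<n) ∷ inRange) =
  subst (_ ∈_) (sym (wordsOver-suc n (length x)))
        (∈-cartesianProductWith⁺ _∷_ (∈-map⁺ suc (∈-upTo⁺ a<n)) (∈-wordsOver⁺ n inRange))

wordsOver-unique : ∀ n k → Unique (wordsOver n k)
wordsOver-unique n zero = [] ∷ []
wordsOver-unique n (suc k) =
  subst Unique (sym (wordsOver-suc n k))
        (Unique.cartesianProductWith⁺ _∷_ ∷-injective (Unique.map⁺ suc-injective (Unique.upTo⁺ n))
                                      (wordsOver-unique n k))

record Valid (n m : ℕ) (x : List ℕ) : Set where
  constructor valid
  field
    length≡ : length x ≡ n
    positive : All (1 ≤_) x
    ascbotNub≡true : ascbotNub x ≡ true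
    has112≡false : has112 x ≡ false
    cayley : isCayley x ≡ true
    maxW≡ : maxW x ≡ m

revAsc-avoiding-σ112 : ∀ x → (isRevAsc x ∧ avoids x σ112) ≡ ((isCayley x ∧ ascbotNub x) ∧ not (has112 x))
revAsc-avoiding-σ112 x rewrite ascbotEqNub≡ascbotNub x | contains-σ112≡has112 x = refl

∧-∧-not≡true : ∀ a b c → ((a ∧ b) ∧ not c) ≡ true → a ≡ true × b ≡ true × c ≡ false
∧-∧-not≡true true true false _ = refl , refl , refl

∈-Bhat⁻ : ∀ {n x} → x ∈ Bhat n σ112 → Valid n (maxW x) x × All (_≤ n) x
∈-Bhat⁻ {n} {x} x∈
  with x∈words , ok ← ∈-filter⁻ (λ x → isRevAsc x ∧ avoids x σ112 Bool.≟ true) x∈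
  with length≡ , inRange ← ∈-wordsOver⁻ n n x∈words
  with cayley , ascbotNub≡ , has112≡ ← ∧-∧-not≡true _ _ _ (trans (sym (revAsc-avoiding-σ112 x)) ok)
  = valid length≡ (All.map proj₁ inRange) ascbotNub≡ has112≡ cayley refl , All.map proj₂ inRange

∈-Bhat112⁻ : ∀ {n m x} → x ∈ Bhat112 n m → Valid n m x × All (_≤ n) x
∈-Bhat112⁻ {n} {m} x∈
  with x∈Bhat , maxW≡ ← ∈-filter⁻ (λ x → maxW x ≟ m) x∈
  with valid length≡ positive ascbotNub≡ has112≡ cayley _ , bounded ← ∈-Bhat⁻ x∈Bhat
  = valid length≡ positive ascbotNub≡ has112≡ cayley maxW≡ , bounded

∈-Bhat112⁺ : ∀ {n m x} → Valid n m x → All (_≤ n) x → x ∈ Bhat112 n m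
∈-Bhat112⁺ {n} {m} {x} (valid refl positive ascbotNub≡ has112≡ cayley maxW≡) bounded =
  ∈-filter⁺ (λ x → maxW x ≟ m)
    (∈-filter⁺ (λ x → isRevAsc x ∧ avoids x σ112 Bool.≟ true)
      (∈-wordsOver⁺ n (All.zip (positive , bounded)))
      (trans (revAsc-avoiding-σ112 x) (cong₂ _∧_ (cong₂ _∧_ cayley ascbotNub≡) (cong not has112≡))))
    maxW≡

Bhat112-unique : ∀ n m → Unique (Bhat112 n m)
Bhat112-unique n m =
  Unique.filter⁺ (λ x → maxW x ≟ m)
    (Unique.filter⁺ (λ x → isRevAsc x ∧ avoids x σ112 Bool.≟ true) (wordsOver-unique n n))

maxW-++ : ∀ xs ys → maxW (xs ++ ys) ≡ maxW xs ⊔ maxW ys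
maxW-++ [] ys = refl
maxW-++ (x ∷ xs) ys = trans (cong (x ⊔_) (maxW-++ xs ys)) (sym (⊔-assoc x (maxW xs) (maxW ys)))

maxW-map-suc : ∀ y → 1 ⊔ maxW (map suc y) ≡ suc (maxW y)
maxW-map-suc [] = refl
maxW-map-suc (a ∷ y) = begin
  1 ⊔ (suc a ⊔ maxW (map suc y))   ≡⟨ sym (⊔-assoc 1 (suc a) (maxW (map suc y))) ⟩
  suc a ⊔ maxW (map suc y)         ≡⟨ cong (λ t → suc t ⊔ maxW (map suc y)) (sym (⊔-identityʳ a)) ⟩
  (suc a ⊔ 1) ⊔ maxW (map suc y)   ≡⟨ ⊔-assoc (suc a) 1 (maxW (map suc y)) ⟩
  suc a ⊔ (1 ⊔ maxW (map suc y))   ≡⟨ cong (suc a ⊔_) (maxW-map-suc y) ⟩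
  suc (a ⊔ maxW y)                 ∎
  where open ≡-Reasoning

maxW-insert : ∀ P Q → maxW (P ++ 1 ∷ Q) ≡ 1 ⊔ maxW (P ++ Q)
maxW-insert [] Q = refl
maxW-insert (a ∷ P) Q = begin
  a ⊔ maxW (P ++ 1 ∷ Q)     ≡⟨ cong (a ⊔_) (maxW-insert P Q) ⟩
  a ⊔ (1 ⊔ maxW (P ++ Q))   ≡⟨ sym (⊔-assoc a 1 (maxW (P ++ Q))) ⟩
  (a ⊔ 1) ⊔ maxW (P ++ Q)   ≡⟨ cong (_⊔ maxW (P ++ Q)) (⊔-comm a 1) ⟩
  (1 ⊔ a) ⊔ maxW (P ++ Q)   ≡⟨ ⊔-assoc 1 a (maxW (P ++ Q)) ⟩
  1 ⊔ (a ⊔ maxW (P ++ Q))   ∎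
  where open ≡-Reasoning

≤-maxW : ∀ x → All (_≤ maxW x) x
≤-maxW [] = []
≤-maxW (a ∷ x) = m≤m⊔n a (maxW x) ∷ All.map (λ b≤ → ≤-trans b≤ (m≤n⊔m a (maxW x))) (≤-maxW x)

maxW-≤ : ∀ {K} x → All (_≤ K) x → maxW x ≤ K
maxW-≤ [] [] = z≤n
maxW-≤ (a ∷ x) (a≤K ∷ x≤K) = ⊔-lub a≤K (maxW-≤ x x≤K)

elemᵇ⇒∈ : ∀ v xs → elemᵇ v xs ≡ true → v ∈ xs
elemᵇ⇒∈ v (x ∷ xs) elem with v ≡ᵇ x in eq
... | true = here (≡ᵇ⇒≡ v x (≡true⇒T eq))
... | false = there (elemᵇ⇒∈ v xs elem)

elemᵇ-map-suc : ∀ a xs → elemᵇ (suc a) (map suc xs) ≡ elemᵇ a xs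
elemᵇ-map-suc a = any-map (suc a ≡ᵇ_) suc

anyAbove-map-suc : ∀ a xs → anyAbove (suc a) (map suc xs) ≡ anyAbove a xs
anyAbove-map-suc a = any-map (suc a <ᵇ_) suc

elemᵇ-insert : ∀ c P Q → 2 ≤ c → elemᵇ c (P ++ 1 ∷ Q) ≡ elemᵇ c (P ++ Q)
elemᵇ-insert c@(suc (suc _)) P Q _ = trans (any-++ (c ≡ᵇ_) P (1 ∷ Q)) (sym (any-++ (c ≡ᵇ_) P Q))
elemᵇ-insert (suc zero) P Q (s≤s ())

cayley⇒elemᵇ1 : ∀ {m} y → maxW y ≡ suc m → isCayley y ≡ true → elemᵇ 1 y ≡ true
cayley⇒elemᵇ1 {m} y maxW≡ cayley =
  ∧-conicalˡ _ _ (trans (sym (cong and (map-upTo-suc (λ v → elemᵇ (suc v) y) m)))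
                        (subst (λ M → all (λ v → elemᵇ (suc v) y) (upTo M) ≡ true) maxW≡ cayley))

elemᵇ⇒≤maxW : ∀ v y → elemᵇ v y ≡ true → v ≤ maxW y
elemᵇ⇒≤maxW v y v∈y = All.lookup (≤-maxW y) (elemᵇ⇒∈ v y v∈y)

length-insert : ∀ (P Q : List ℕ) → length (P ++ 1 ∷ Q) ≡ suc (length (P ++ Q))
length-insert P Q = trans (length-++ P) (trans (+-suc (length P) (length Q)) (cong suc (sym (length-++ P))))

length-∷ʳ : ∀ (y : List ℕ) a → length (y ∷ʳ a) ≡ suc (length y)
length-∷ʳ y a = trans (length-++ y) (+-comm (length y) 1)

anyAbove-insert : ∀ a P Q → 1 ≤ a → anyAbove a (P ++ 1 ∷ Q) ≡ anyAbove a (P ++ Q)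
anyAbove-insert (suc a) [] Q _ = refl
anyAbove-insert a (c ∷ P) Q 1≤a = cong ((a <ᵇ c) ∨_) (anyAbove-insert a P Q 1≤a)

ascbotNubAfter-∷ʳ1 : ∀ seen ys → All (1 ≤_) ys →
  ascbotNubAfter seen (ys ∷ʳ 1) ≡ ascbotNubAfter seen ys ∧ elemᵇ 1 (seen ++ ys)
ascbotNubAfter-∷ʳ1 seen [] [] =
  trans (∧-identityʳ _) (trans (not-involutive _) (cong (elemᵇ 1) (sym (++-identityʳ seen))))
ascbotNubAfter-∷ʳ1 seen (e ∷ ys) (1≤e ∷ ys-pos) = begin
  eqB (e <ᵇ at (ys ∷ʳ 1) 0) fresh ∧ ascbotNubAfter (seen ∷ʳ e) (ys ∷ʳ 1)
    ≡⟨ cong₂ _∧_ (cong (λ t → eqB t fresh) (next-unchanged ys 1≤e)) (ascbotNubAfter-∷ʳ1 (seen ∷ʳ e) ys ys-pos) ⟩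
  eqB (e <ᵇ at ys 0) fresh ∧ (ascbotNubAfter (seen ∷ʳ e) ys ∧ elemᵇ 1 ((seen ∷ʳ e) ++ ys))
    ≡⟨ sym (∧-assoc (eqB (e <ᵇ at ys 0) fresh) _ _) ⟩
  (eqB (e <ᵇ at ys 0) fresh ∧ ascbotNubAfter (seen ∷ʳ e) ys) ∧ elemᵇ 1 ((seen ∷ʳ e) ++ ys)
    ≡⟨ cong (λ s → (eqB (e <ᵇ at ys 0) fresh ∧ ascbotNubAfter (seen ∷ʳ e) ys) ∧ elemᵇ 1 s) (++-assoc seen [ e ] ys) ⟩
  (eqB (e <ᵇ at ys 0) fresh ∧ ascbotNubAfter (seen ∷ʳ e) ys) ∧ elemᵇ 1 (seen ++ e ∷ ys) ∎
  where
  open ≡-Reasoning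
  fresh : Bool
  fresh = not (elemᵇ e seen)
  next-unchanged : ∀ ys → 1 ≤ e → (e <ᵇ at (ys ∷ʳ 1) 0) ≡ (e <ᵇ at ys 0)
  next-unchanged [] (s≤s z≤n) = refl
  next-unchanged (_ ∷ _) _ = refl

repeatThenAbove-∷ʳ1 : ∀ a ys → 1 ≤ a → repeatThenAbove a (ys ∷ʳ 1) ≡ repeatThenAbove a ys
repeatThenAbove-∷ʳ1 a [] _ = cong (_∨ false) (∧-zeroʳ (a ≡ᵇ 1))
repeatThenAbove-∷ʳ1 a (b ∷ ys) 1≤a =
  cong₂ _∨_ (cong ((a ≡ᵇ b) ∧_) (trans (anyAbove-insert a ys [] 1≤a) (cong (anyAbove a) (++-identityʳ ys))))
            (repeatThenAbove-∷ʳ1 a ys 1≤a)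

has112-∷ʳ1 : ∀ y → All (1 ≤_) y → has112 (y ∷ʳ 1) ≡ has112 y
has112-∷ʳ1 [] [] = refl
has112-∷ʳ1 (a ∷ y) (1≤a ∷ y-pos) = cong₂ _∨_ (repeatThenAbove-∷ʳ1 a y 1≤a) (has112-∷ʳ1 y y-pos)

maxW-∷ʳ1 : ∀ y → 1 ≤ maxW y → maxW (y ∷ʳ 1) ≡ maxW y
maxW-∷ʳ1 y 1≤max = trans (maxW-++ y [ 1 ]) (m≥n⇒m⊔n≡m 1≤max)

isCayley-∷ʳ1 : ∀ y → elemᵇ 1 y ≡ true → isCayley (y ∷ʳ 1) ≡ isCayley y
isCayley-∷ʳ1 y 1∈y =
  trans (cong (λ M → all (λ v → elemᵇ (suc v) (y ∷ʳ 1)) (upTo M)) (maxW-∷ʳ1 y (elemᵇ⇒≤maxW 1 y 1∈y)))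
        (cong and (map-cong same-values (upTo (maxW y))))
  where
  same-values : ∀ v → elemᵇ (suc v) (y ∷ʳ 1) ≡ elemᵇ (suc v) y
  same-values zero = trans (any-++ (1 ≡ᵇ_) y [ 1 ]) (trans (∨-zeroʳ (elemᵇ 1 y)) (sym 1∈y))
  same-values (suc v) = trans (any-++ (suc (suc v) ≡ᵇ_) y [ 1 ]) (∨-identityʳ _)

valid-∷ʳ1 : ∀ {n m y} → Valid (suc n) (suc m) y → Valid (suc (suc n)) (suc m) (y ∷ʳ 1)
valid-∷ʳ1 {y = []} (valid () _ _ _ _ _)
valid-∷ʳ1 {y = y@(a ∷ ys)} (valid length≡ positive ascbotNub≡ has112≡ cayley maxW≡) =
  valid (trans (length-∷ʳ y 1) (cong suc length≡))
        (AllP.++⁺ positive (s≤s z≤n ∷ []))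
        (trans (ascbotNubAfter-∷ʳ1 [ a ] ys (All.tail positive)) (cong₂ _∧_ ascbotNub≡ 1∈y))
        (trans (has112-∷ʳ1 y positive) has112≡)
        (trans (isCayley-∷ʳ1 y 1∈y) cayley)
        (trans (maxW-∷ʳ1 y (elemᵇ⇒≤maxW 1 y 1∈y)) maxW≡)
  where
  1∈y : elemᵇ 1 y ≡ true
  1∈y = cayley⇒elemᵇ1 y maxW≡ cayley

valid-∷ʳ1⁻ : ∀ {n m a ys} → Valid (suc (suc n)) m ((a ∷ ys) ∷ʳ 1) → Valid (suc n) m (a ∷ ys)
valid-∷ʳ1⁻ {a = a} {ys} (valid length≡ positive ascbotNub≡ has112≡ cayley maxW≡) =
  valid (suc-injective (trans (sym (length-∷ʳ (a ∷ ys) 1)) length≡))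
        y-pos
        (∧-conicalˡ _ _ ascbotNub∧1∈y)
        (trans (sym (has112-∷ʳ1 (a ∷ ys) y-pos)) has112≡)
        (trans (sym (isCayley-∷ʳ1 (a ∷ ys) 1∈y)) cayley)
        (trans (sym (maxW-∷ʳ1 (a ∷ ys) (elemᵇ⇒≤maxW 1 (a ∷ ys) 1∈y))) maxW≡)
  where
  y-pos : All (1 ≤_) (a ∷ ys)
  y-pos = AllP.++⁻ˡ (a ∷ ys) positive
  ascbotNub∧1∈y : ascbotNub (a ∷ ys) ∧ elemᵇ 1 (a ∷ ys) ≡ true
  ascbotNub∧1∈y = trans (sym (ascbotNubAfter-∷ʳ1 [ a ] ys (All.tail y-pos))) ascbotNub≡
  1∈y : elemᵇ 1 (a ∷ ys) ≡ true
  1∈y = ∧-conicalʳ _ _ ascbotNub∧1∈y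

ascbotNubAfter-map-suc : ∀ seen r → ascbotNubAfter (map suc seen) (map suc r) ≡ ascbotNubAfter seen r
ascbotNubAfter-map-suc seen [] = refl
ascbotNubAfter-map-suc seen (b ∷ r) =
  cong₂ _∧_ (cong₂ eqB (next-shift r) (cong not (elemᵇ-map-suc b seen)))
            (trans (cong (λ s → ascbotNubAfter s (map suc r)) (sym (map-++ suc seen [ b ])))
                   (ascbotNubAfter-map-suc (seen ∷ʳ b) r))
  where
  next-shift : ∀ r → (suc b <ᵇ at (map suc r) 0) ≡ (b <ᵇ at r 0)
  next-shift [] = refl
  next-shift (_ ∷ _) = refl

ascbotNub-map-suc : ∀ y → ascbotNub (map suc y) ≡ ascbotNub y
ascbotNub-map-suc [] = refl
ascbotNub-map-suc (a ∷ y) = ascbotNubAfter-map-suc [ a ] y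

repeatThenAbove-map-suc : ∀ a xs → repeatThenAbove (suc a) (map suc xs) ≡ repeatThenAbove a xs
repeatThenAbove-map-suc a [] = refl
repeatThenAbove-map-suc a (b ∷ xs) =
  cong₂ _∨_ (cong ((a ≡ᵇ b) ∧_) (anyAbove-map-suc a xs)) (repeatThenAbove-map-suc a xs)

has112-map-suc : ∀ xs → has112 (map suc xs) ≡ has112 xs
has112-map-suc [] = refl
has112-map-suc (a ∷ xs) = cong₂ _∨_ (repeatThenAbove-map-suc a xs) (has112-map-suc xs)

data _≤Last_ (b : ℕ) : List ℕ → Set where
  []  : b ≤Last []
  single : ∀ {e} → b ≤ e → b ≤Last [ e ]
  _∷_ : ∀ e {f p} → b ≤Last (f ∷ p) → b ≤Last (e ∷ f ∷ p)

≤Last-intro : ∀ b p → (∀ u e → p ≡ u ∷ʳ e → b ≤ e) → b ≤Last p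
≤Last-intro b [] _ = []
≤Last-intro b (e ∷ []) b≤last = single (b≤last [] e refl)
≤Last-intro b (e ∷ f ∷ p) b≤last = e ∷ ≤Last-intro b (f ∷ p) (λ u e′ eq → b≤last (e ∷ u) e′ (cong (e ∷_) eq))

ascbotNubAfter-cong : ∀ seen seen′ r → (∀ c → 2 ≤ c → elemᵇ c seen ≡ elemᵇ c seen′) → All (2 ≤_) r →
  ascbotNubAfter seen r ≡ ascbotNubAfter seen′ r
ascbotNubAfter-cong seen seen′ [] _ _ = refl
ascbotNubAfter-cong seen seen′ (b ∷ r) same (2≤b ∷ r≥2) =
  cong₂ _∧_ (cong (λ t → eqB (b <ᵇ at r 0) (not t)) (same b 2≤b))
            (ascbotNubAfter-cong (seen ∷ʳ b) (seen′ ∷ʳ b) r same′ r≥2)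
  where
  same′ : ∀ c → 2 ≤ c → elemᵇ c (seen ∷ʳ b) ≡ elemᵇ c (seen′ ∷ʳ b)
  same′ c 2≤c = trans (any-++ (c ≡ᵇ_) seen [ b ])
                      (trans (cong (_∨ elemᵇ c [ b ]) (same c 2≤c)) (sym (any-++ (c ≡ᵇ_) seen′ [ b ])))

1∉-∷ʳ : ∀ seen e → elemᵇ 1 seen ≡ false → 2 ≤ e → elemᵇ 1 (seen ∷ʳ e) ≡ false
1∉-∷ʳ seen e@(suc (suc _)) 1∉seen _ = trans (any-++ (1 ≡ᵇ_) seen [ e ]) (cong (_∨ false) 1∉seen)
1∉-∷ʳ seen (suc zero) _ (s≤s ())

ascbotNubAfter-insert : ∀ seen p b q → elemᵇ 1 seen ≡ false → All (2 ≤_) p → 2 ≤ b → All (2 ≤_) q →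
  b ≤Last p → ascbotNubAfter seen (p ++ 1 ∷ b ∷ q) ≡ ascbotNubAfter seen (p ++ b ∷ q)
ascbotNubAfter-insert seen [] b@(suc (suc _)) q 1∉seen [] 2≤b q≥2 [] rewrite 1∉seen =
  ascbotNubAfter-cong (seen ∷ʳ 1) seen (b ∷ q)
    (λ c 2≤c → trans (elemᵇ-insert c seen [] 2≤c) (cong (elemᵇ c) (++-identityʳ seen))) (2≤b ∷ q≥2)
ascbotNubAfter-insert seen [] (suc zero) q _ [] (s≤s ()) _ []
ascbotNubAfter-insert seen (e ∷ []) b q 1∉seen (2≤e ∷ []) 2≤b q≥2 (single b≤e) =
  cong₂ _∧_ (cong (λ t → eqB t (not (elemᵇ e seen)))
                  (trans (≤⇒<ᵇ-false (2≤⇒1≤ 2≤e)) (sym (≤⇒<ᵇ-false b≤e))))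
            (ascbotNubAfter-insert (seen ∷ʳ e) [] b q (1∉-∷ʳ seen e 1∉seen 2≤e) [] 2≤b q≥2 [])
ascbotNubAfter-insert seen (e ∷ f ∷ p) b q 1∉seen (2≤e ∷ p≥2) 2≤b q≥2 (_ ∷ slot) =
  cong (eqB (e <ᵇ f) (not (elemᵇ e seen)) ∧_)
       (ascbotNubAfter-insert (seen ∷ʳ e) (f ∷ p) b q (1∉-∷ʳ seen e 1∉seen 2≤e) p≥2 2≤b q≥2 slot)

ascbotNub-insert : ∀ a p b q → All (2 ≤_) (a ∷ p ++ b ∷ q) → b ≤Last p →
  ascbotNub (a ∷ p ++ 1 ∷ b ∷ q) ≡ ascbotNub (a ∷ p ++ b ∷ q)
ascbotNub-insert a p b q (2≤a ∷ w≥2) slot with AllP.++⁻ p w≥2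
... | p≥2 , 2≤b ∷ q≥2 = ascbotNubAfter-insert [ a ] p b q (1∉-∷ʳ [] a refl 2≤a) p≥2 2≤b q≥2 slot

repeatThenAbove-insert : ∀ a P Q → 2 ≤ a → repeatThenAbove a (P ++ 1 ∷ Q) ≡ repeatThenAbove a (P ++ Q)
repeatThenAbove-insert (suc (suc a)) [] Q _ = refl
repeatThenAbove-insert (suc zero) [] Q (s≤s ())
repeatThenAbove-insert a (c ∷ P) Q 2≤a =
  cong₂ _∨_ (cong ((a ≡ᵇ c) ∧_) (anyAbove-insert a P Q (2≤⇒1≤ 2≤a)))
            (repeatThenAbove-insert a P Q 2≤a)

repeatThenAbove-1 : ∀ Q → All (2 ≤_) Q → repeatThenAbove 1 Q ≡ false
repeatThenAbove-1 [] [] = refl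
repeatThenAbove-1 (suc (suc _) ∷ Q) (_ ∷ Q≥2) = repeatThenAbove-1 Q Q≥2
repeatThenAbove-1 (suc zero ∷ Q) (s≤s () ∷ _)

has112-insert : ∀ P Q → All (2 ≤_) P → All (2 ≤_) Q → has112 (P ++ 1 ∷ Q) ≡ has112 (P ++ Q)
has112-insert [] Q [] Q≥2 = cong (_∨ has112 Q) (repeatThenAbove-1 Q Q≥2)
has112-insert (a ∷ P) Q (2≤a ∷ P≥2) Q≥2 =
  cong₂ _∨_ (repeatThenAbove-insert a P Q 2≤a) (has112-insert P Q P≥2 Q≥2)

isCayley-insert : ∀ P Q y → P ++ Q ≡ map suc y → isCayley (P ++ 1 ∷ Q) ≡ isCayley y
isCayley-insert P Q y shift = begin
  all (λ v → elemᵇ (suc v) (P ++ 1 ∷ Q)) (upTo (maxW (P ++ 1 ∷ Q)))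
    ≡⟨ cong (λ M → all (λ v → elemᵇ (suc v) (P ++ 1 ∷ Q)) (upTo M)) maxW≡ ⟩
  all (λ v → elemᵇ (suc v) (P ++ 1 ∷ Q)) (upTo (suc (maxW y)))
    ≡⟨ cong and (map-upTo-suc (λ v → elemᵇ (suc v) (P ++ 1 ∷ Q)) (maxW y)) ⟩
  elemᵇ 1 (P ++ 1 ∷ Q) ∧ all (λ v → elemᵇ (suc (suc v)) (P ++ 1 ∷ Q)) (upTo (maxW y))
    ≡⟨ cong₂ _∧_ 1∈ (cong and (map-cong shifted-values (upTo (maxW y)))) ⟩
  all (λ v → elemᵇ (suc v) y) (upTo (maxW y)) ∎
  where
  open ≡-Reasoning
  maxW≡ : maxW (P ++ 1 ∷ Q) ≡ suc (maxW y)
  maxW≡ = trans (maxW-insert P Q) (trans (cong (λ z → 1 ⊔ maxW z) shift) (maxW-map-suc y))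
  1∈ : elemᵇ 1 (P ++ 1 ∷ Q) ≡ true
  1∈ = trans (any-++ (1 ≡ᵇ_) P (1 ∷ Q)) (∨-zeroʳ _)
  shifted-values : ∀ v → elemᵇ (suc (suc v)) (P ++ 1 ∷ Q) ≡ elemᵇ (suc v) y
  shifted-values v = trans (elemᵇ-insert (suc (suc v)) P Q (s≤s (s≤s z≤n)))
                           (trans (cong (elemᵇ (suc (suc v))) shift) (elemᵇ-map-suc (suc v) y))

module Insertion {y a p b q} (shift : map suc y ≡ a ∷ p ++ b ∷ q) (y-pos : All (1 ≤_) y) (slot : b ≤Last p) where

  w≥2 : All (2 ≤_) (a ∷ p ++ b ∷ q)
  w≥2 = subst (All (2 ≤_)) shift (AllP.map⁺ (All.map s≤s y-pos))

  private
    P Q x : List ℕ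
    P = a ∷ p
    Q = b ∷ q
    x = a ∷ p ++ 1 ∷ b ∷ q

    length-x : length x ≡ suc (length y)
    length-x = cong suc (trans (length-insert p Q) (trans (cong length (sym shift)) (length-map suc y)))

    ascbotNub-x : ascbotNub x ≡ ascbotNub y
    ascbotNub-x = trans (ascbotNub-insert a p b q w≥2 slot) (trans (cong ascbotNub (sym shift)) (ascbotNub-map-suc y))

    has112-x : has112 x ≡ has112 y
    has112-x = trans (has112-insert P Q (AllP.++⁻ˡ P w≥2) (AllP.++⁻ʳ P w≥2))
                     (trans (cong has112 (sym shift)) (has112-map-suc y))

    isCayley-x : isCayley x ≡ isCayley y
    isCayley-x = isCayley-insert P Q y (sym shift)

    maxW-x : maxW x ≡ suc (maxW y)
    maxW-x = trans (maxW-insert P Q) (trans (cong (λ z → 1 ⊔ maxW z) (sym shift)) (maxW-map-suc y))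

    positive-x : All (1 ≤_) x
    positive-x with AllP.++⁻ P w≥2
    ... | P≥2 , Q≥2 = AllP.++⁺ (All.map 2≤⇒1≤ P≥2) (s≤s z≤n ∷ All.map 2≤⇒1≤ Q≥2)

  valid-insert : ∀ {n m} → Valid (suc n) m y → Valid (suc (suc n)) (suc m) (a ∷ p ++ 1 ∷ b ∷ q)
  valid-insert (valid length≡ _ ascbotNub≡ has112≡ cayley maxW≡) =
    valid (trans length-x (cong suc length≡)) positive-x (trans ascbotNub-x ascbotNub≡) (trans has112-x has112≡)
          (trans isCayley-x cayley) (trans maxW-x (cong suc maxW≡))

  valid-insert⁻ : ∀ {n m} → Valid (suc (suc n)) (suc m) (a ∷ p ++ 1 ∷ b ∷ q) → Valid (suc n) m y
  valid-insert⁻ (valid length≡ _ ascbotNub≡ has112≡ cayley maxW≡) =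
    valid (suc-injective (trans (sym length-x) length≡)) y-pos (trans (sym ascbotNub-x) ascbotNub≡)
          (trans (sym has112-x) has112≡) (trans (sym isCayley-x) cayley) (suc-injective (trans (sym maxW-x) maxW≡))

-- The recursive construction

descentInsertions : ℕ → List ℕ → List (List ℕ)
descentInsertions e [] = []
descentInsertions e (b ∷ r) =
  (if b ≤ᵇ e then [ e ∷ 1 ∷ b ∷ r ] else []) ++ map (e ∷_) (descentInsertions b r)

insertions : List ℕ → List (List ℕ)
insertions (a ∷ b ∷ r) = (a ∷ 1 ∷ b ∷ r) ∷ map (a ∷_) (descentInsertions b r)
insertions _ = []

∈-descentInsertions⁻ : ∀ e r {z} → z ∈ descentInsertions e r →
  ∃₂ λ p b → ∃ λ q → r ≡ p ++ b ∷ q × z ≡ e ∷ p ++ 1 ∷ b ∷ q × b ≤Last (e ∷ p)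
∈-descentInsertions⁻ e (b ∷ r) z∈ with ∈-++⁻ (if b ≤ᵇ e then [ e ∷ 1 ∷ b ∷ r ] else []) z∈
... | inj₁ z∈first with b ≤ᵇ e in b≤ᵇe | z∈first
...   | true | here refl = [] , b , r , refl , refl , single (≤ᵇ⇒≤ b e (≡true⇒T b≤ᵇe))
∈-descentInsertions⁻ e (b ∷ r) z∈ | inj₂ z∈later
  with z′ , z′∈ , refl ← ∈-map⁻ (e ∷_) z∈later
  with p , b′ , q , refl , refl , slot ← ∈-descentInsertions⁻ b r z′∈
  = b ∷ p , b′ , q , refl , refl , e ∷ slot

∈-insertions⁻ : ∀ w {z} → z ∈ insertions w →
  ∃₂ λ a p → ∃₂ λ b q → w ≡ a ∷ p ++ b ∷ q × z ≡ a ∷ p ++ 1 ∷ b ∷ q × b ≤Last p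
∈-insertions⁻ (a ∷ b ∷ r) (here refl) = a , [] , b , r , refl , refl , []
∈-insertions⁻ (a ∷ b ∷ r) (there z∈)
  with z′ , z′∈ , refl ← ∈-map⁻ (a ∷_) z∈
  with p , b′ , q , refl , refl , slot ← ∈-descentInsertions⁻ b r z′∈
  = a , b ∷ p , b′ , q , refl , refl , slot

∈-descentInsertions⁺ : ∀ e p b q → b ≤Last (e ∷ p) → (e ∷ p ++ 1 ∷ b ∷ q) ∈ descentInsertions e (p ++ b ∷ q)
∈-descentInsertions⁺ e [] b q (single b≤e) rewrite T⇒≡true (≤⇒≤ᵇ b≤e) = here refl
∈-descentInsertions⁺ e (c ∷ p) b q (_ ∷ slot) =
  ∈-++⁺ʳ (if c ≤ᵇ e then [ e ∷ 1 ∷ c ∷ p ++ b ∷ q ] else []) (∈-map⁺ (e ∷_) (∈-descentInsertions⁺ c p b q slot))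

∈-insertions⁺ : ∀ a p b q → b ≤Last p → (a ∷ p ++ 1 ∷ b ∷ q) ∈ insertions (a ∷ p ++ b ∷ q)
∈-insertions⁺ a [] b q [] = here refl
∈-insertions⁺ a (c ∷ p) b q slot = there (∈-map⁺ (a ∷_) (∈-descentInsertions⁺ c p b q slot))

generated : ℕ → ℕ → List (List ℕ)
generated (suc zero) (suc zero) = [ [ 1 ] ]
generated (suc (suc n)) (suc m) =
  map (_∷ʳ 1) (generated (suc n) (suc m)) ++ concatMap (λ y → insertions (map suc y)) (generated (suc n) m)
generated _ _ = []

data GeneratedStep (n m : ℕ) : List ℕ → Set where
  appended : ∀ {y} → y ∈ generated (suc n) (suc m) → GeneratedStep n m (y ∷ʳ 1)
  inserted : ∀ {y a p b q} → y ∈ generated (suc n) m → map suc y ≡ a ∷ p ++ b ∷ q → b ≤Last p →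
             GeneratedStep n m (a ∷ p ++ 1 ∷ b ∷ q)

∈-concatMap⁻′ : ∀ {A B : Set} (f : A → List B) xs {z} → z ∈ concatMap f xs → ∃ λ x → x ∈ xs × z ∈ f x
∈-concatMap⁻′ f xs z∈ = find (∈-concatMap⁻ f {xs} z∈)

generated-step : ∀ n m {x} → x ∈ generated (suc (suc n)) (suc m) → GeneratedStep n m x
generated-step n m x∈ with ∈-++⁻ (map (_∷ʳ 1) (generated (suc n) (suc m))) x∈
... | inj₁ x∈appended with y , y∈ , refl ← ∈-map⁻ (_∷ʳ 1) x∈appended = appended y∈
... | inj₂ x∈inserted
  with y , y∈ , x∈ys ← ∈-concatMap⁻′ (λ y → insertions (map suc y)) (generated (suc n) m) x∈inserted
  with a , p , b , q , shift , refl , slot ← ∈-insertions⁻ (map suc y) x∈ys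
  = inserted y∈ shift slot

GeneratedStep-valid : ∀ {n m x} → (∀ m′ {y} → y ∈ generated (suc n) m′ → Valid (suc n) m′ y) →
  GeneratedStep n m x → Valid (suc (suc n)) (suc m) x
GeneratedStep-valid {m = m} valid-y (appended y∈) = valid-∷ʳ1 (valid-y (suc m) y∈)
GeneratedStep-valid {m = m} valid-y (inserted y∈ shift slot) =
  Insertion.valid-insert shift (Valid.positive (valid-y m y∈)) slot (valid-y m y∈)

generated-sound : ∀ n m {x} → x ∈ generated n m → Valid n m x
generated-sound (suc zero) (suc zero) (here refl) = valid refl (s≤s z≤n ∷ []) refl refl refl refl
generated-sound (suc (suc n)) (suc m) x∈ = GeneratedStep-valid (generated-sound (suc n)) (generated-step n m x∈)

-- Completeness: decomposition at the last 1

split-at-last : ∀ v x → elemᵇ v x ≡ true → ∃₂ λ r s → x ≡ r ++ v ∷ s × elemᵇ v s ≡ false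
split-at-last v (c ∷ x) v∈ with elemᵇ v x in v∈x
... | true with r , s , refl , v∉s ← split-at-last v x v∈x = c ∷ r , s , refl , v∉s
... | false with v ≡ᵇ c in v≡ᵇc
...   | true with refl ← ≡ᵇ⇒≡ v c (≡true⇒T v≡ᵇc) = [] , x , refl , v∈x
split-at-last v (c ∷ x) () | false | false

above-1 : ∀ r → All (1 ≤_) r → elemᵇ 1 r ≡ false → All (2 ≤_) r
above-1 [] [] _ = []
above-1 (suc (suc _) ∷ r) (_ ∷ r-pos) 1∉r = s≤s (s≤s z≤n) ∷ above-1 r r-pos 1∉r

repeatThenAbove-++ : ∀ v {e} w → repeatThenAbove e w ≡ true → repeatThenAbove e (v ++ w) ≡ true
repeatThenAbove-++ [] w found = found
repeatThenAbove-++ (c ∷ v) {e} w found =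
  trans (cong (((e ≡ᵇ c) ∧ anyAbove e (v ++ w)) ∨_) (repeatThenAbove-++ v w found)) (∨-zeroʳ _)

has112-++ : ∀ {e} v w → e ∈ v → repeatThenAbove e w ≡ true → has112 (v ++ w) ≡ true
has112-++ (c ∷ v) w (here refl) found = cong (_∨ has112 (v ++ w)) (repeatThenAbove-++ v w found)
has112-++ (c ∷ v) w (there e∈v) found =
  trans (cong (repeatThenAbove c (v ++ w) ∨_) (has112-++ v w e∈v found)) (∨-zeroʳ _)

ascbotNubAfter-++ : ∀ seen u rest → ascbotNubAfter seen (u ++ rest) ≡ true → ascbotNubAfter (seen ++ u) rest ≡ true
ascbotNubAfter-++ seen [] rest ok = subst (λ s → ascbotNubAfter s rest ≡ true) (sym (++-identityʳ seen)) ok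
ascbotNubAfter-++ seen (c ∷ u) rest ok =
  subst (λ s → ascbotNubAfter s rest ≡ true) (++-assoc seen [ c ] u)
        (ascbotNubAfter-++ (seen ∷ʳ c) u rest (∧-conicalʳ _ _ ok))

new⇒ascbot : ∀ seen c xs → elemᵇ c seen ≡ false → ascbotNubAfter seen (c ∷ xs) ≡ true →
  (c <ᵇ at xs 0) ≡ true × ascbotNubAfter (seen ∷ʳ c) xs ≡ true
new⇒ascbot seen c xs c∉seen ok rewrite c∉seen with c <ᵇ at xs 0
... | true = refl , ok

not-ascbot⇒repeated : ∀ seen c xs → (c <ᵇ at xs 0) ≡ false → ascbotNubAfter seen (c ∷ xs) ≡ true →
  elemᵇ c seen ≡ true
not-ascbot⇒repeated seen c xs no-ascent ok rewrite no-ascent =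
  trans (sym (not-involutive (elemᵇ c seen))) (∧-conicalˡ _ _ ok)

above-all⇒∉ : ∀ c seen → All (_< c) seen → elemᵇ c seen ≡ false
above-all⇒∉ c [] [] = refl
above-all⇒∉ c (e ∷ seen) (e<c ∷ below) = cong₂ _∨_ (≢⇒≡ᵇ-false (>⇒≢ e<c)) (above-all⇒∉ c seen below)

-- a new maximum is an ascent bottom, so the next entry is a new maximum again,
-- and so on up to the last entry, which cannot be an ascent bottom
new-maximum⇒¬ascbotNubAfter : ∀ seen c xs → All (_< c) seen → ascbotNubAfter seen (c ∷ xs) ≢ true
new-maximum⇒¬ascbotNubAfter seen c [] below ok with new⇒ascbot seen c [] (above-all⇒∉ c seen below) ok
... | () , _
new-maximum⇒¬ascbotNubAfter seen c (d ∷ xs) below ok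
  with c<ᵇd , ok′ ← new⇒ascbot seen c (d ∷ xs) (above-all⇒∉ c seen below) ok
  = new-maximum⇒¬ascbotNubAfter (seen ∷ʳ c) d xs
      (AllP.++⁺ (All.map (λ e<c → <-trans e<c c<d) below) (c<d ∷ [])) ok′
  where
  c<d : c < d
  c<d = <ᵇ⇒< c d (≡true⇒T c<ᵇd)

true≢false : true ≢ false
true≢false ()

repeatThenAbove-hit : ∀ e w b s → e < b → repeatThenAbove e (e ∷ w ++ b ∷ s) ≡ true
repeatThenAbove-hit e w b s e<b =
  cong₂ (λ t u → (t ∧ u) ∨ repeatThenAbove e (w ++ b ∷ s))
        (≡ᵇ-refl e) (T⇒≡true (any⁺ (e <ᵇ_) (Any.++⁺ʳ w (here (<⇒<ᵇ e<b)))))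

-- an entry e < b right before the inserted 1 would not be a nub, and then e … e 1 b contains 112
slot-of-valid : ∀ a p b s → All (1 ≤_) p → ascbotNub (a ∷ p ++ 1 ∷ b ∷ s) ≡ true →
  has112 (a ∷ p ++ 1 ∷ b ∷ s) ≡ false → b ≤Last p
slot-of-valid a p b s p-pos ok no112 = ≤Last-intro b p last≥b
  where
  last≥b : ∀ u e → p ≡ u ∷ʳ e → b ≤ e
  last≥b u e refl with b ≤? e
  ... | yes b≤e = b≤e
  ... | no b≰e = ⊥-elim (true≢false (trans (sym 112-found) no112′))
    where
    reassoc : (u ∷ʳ e) ++ 1 ∷ b ∷ s ≡ u ++ e ∷ 1 ∷ b ∷ s
    reassoc = ++-assoc u [ e ] (1 ∷ b ∷ s)
    1≤e : 1 ≤ e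
    1≤e = All.head (AllP.++⁻ʳ u p-pos)
    e-repeated : elemᵇ e (a ∷ u) ≡ true
    e-repeated = not-ascbot⇒repeated (a ∷ u) e (1 ∷ b ∷ s) (≤⇒<ᵇ-false 1≤e)
                   (ascbotNubAfter-++ [ a ] u (e ∷ 1 ∷ b ∷ s)
                      (subst (λ z → ascbotNubAfter [ a ] z ≡ true) reassoc ok))
    112-found : has112 ((a ∷ u) ++ e ∷ 1 ∷ b ∷ s) ≡ true
    112-found = has112-++ (a ∷ u) (e ∷ 1 ∷ b ∷ s) (elemᵇ⇒∈ e (a ∷ u) e-repeated)
                          (repeatThenAbove-hit e [ 1 ] b s (≰⇒> b≰e))
    no112′ : has112 ((a ∷ u) ++ e ∷ 1 ∷ b ∷ s) ≡ false
    no112′ = subst (λ z → has112 (a ∷ z) ≡ false) reassoc no112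

data Decomposition : List ℕ → Set where
  ends-with-1 : ∀ a ys → Decomposition ((a ∷ ys) ∷ʳ 1)
  single-1 : ∀ a p b q → All (2 ≤_) (a ∷ p ++ b ∷ q) → b ≤Last p → Decomposition (a ∷ p ++ 1 ∷ b ∷ q)

decompose-at-last-1 : ∀ {n m} r b s → Valid (suc (suc n)) (suc m) (r ++ 1 ∷ b ∷ s) → elemᵇ 1 (b ∷ s) ≡ false →
  Decomposition (r ++ 1 ∷ b ∷ s)
decompose-at-last-1 r b s (valid _ positive ok no112 _ _) 1∉bs
  with above-1 (b ∷ s) (All.tail (AllP.++⁻ʳ r positive)) 1∉bs | elemᵇ 1 r in 1∈r
... | bs≥2 | true =
  ⊥-elim (true≢false (trans (sym (has112-++ r (1 ∷ b ∷ s) (elemᵇ⇒∈ 1 r 1∈r)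
                                             (repeatThenAbove-hit 1 [] b s (All.head bs≥2))))
                            no112))
decompose-at-last-1 [] b s (valid _ _ ok _ _ _) _ | 1<b ∷ _ | false =
  ⊥-elim (new-maximum⇒¬ascbotNubAfter [ 1 ] b s (1<b ∷ []) ok)
decompose-at-last-1 (a ∷ p) b s (valid _ positive ok no112 _ _) _ | bs≥2 | false =
  single-1 a p b s (AllP.++⁺ (above-1 (a ∷ p) r-pos 1∈r) bs≥2) (slot-of-valid a p b s (All.tail r-pos) ok no112)
  where
  r-pos : All (1 ≤_) (a ∷ p)
  r-pos = AllP.++⁻ˡ (a ∷ p) positive

decompose : ∀ {n m x} → Valid (suc (suc n)) (suc m) x → Decomposition x
decompose {x = x} v with split-at-last 1 x (cayley⇒elemᵇ1 x (Valid.maxW≡ v) (Valid.cayley v))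
... | [] , [] , refl , _ with Valid.length≡ v
...   | ()
decompose v | a ∷ ys , [] , refl , _ = ends-with-1 a ys
decompose v | r , b ∷ s , refl , 1∉bs = decompose-at-last-1 r b s v 1∉bs

map-suc-pred : ∀ w → All (1 ≤_) w → map suc (map pred w) ≡ w
map-suc-pred [] [] = refl
map-suc-pred (suc a ∷ w) (_ ∷ w-pos) = cong (suc a ∷_) (map-suc-pred w w-pos)

valid⇒1≤max : ∀ {n m x} → Valid (suc n) m x → 1 ≤ m
valid⇒1≤max {x = a ∷ x} (valid _ (1≤a ∷ _) _ _ _ refl) = ≤-trans 1≤a (m≤m⊔n a (maxW x))

generated-complete : ∀ n m {x} → Valid (suc n) m x → x ∈ generated (suc n) m
generated-complete zero m {suc zero ∷ []} (valid _ _ _ _ _ refl) = here refl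
generated-complete zero m {suc (suc _) ∷ []} (valid _ _ _ _ () _)
generated-complete zero m {zero ∷ []} (valid _ (() ∷ _) _ _ _ _)
generated-complete (suc n) zero v with valid⇒1≤max v
... | ()
generated-complete (suc n) (suc m) v with decompose v
... | ends-with-1 a ys = ∈-++⁺ˡ (∈-map⁺ (_∷ʳ 1) (generated-complete n (suc m) (valid-∷ʳ1⁻ v)))
... | single-1 a p b q w≥2 slot =
  ∈-++⁺ʳ (map (_∷ʳ 1) (generated (suc n) (suc m)))
         (∈-concatMap⁺ (λ y → insertions (map suc y))
                       (lose y∈ (subst (λ w → (a ∷ p ++ 1 ∷ b ∷ q) ∈ insertions w) (sym shift) x∈)))
  where
  y : List ℕ
  y = map pred (a ∷ p ++ b ∷ q)
  shift : map suc y ≡ a ∷ p ++ b ∷ q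
  shift = map-suc-pred (a ∷ p ++ b ∷ q) (All.map 2≤⇒1≤ w≥2)
  y-pos : All (1 ≤_) y
  y-pos = AllP.map⁺ (All.map (λ { (s≤s 1≤c) → 1≤c }) w≥2)
  y∈ : y ∈ generated (suc n) m
  y∈ = generated-complete n m (Insertion.valid-insert⁻ shift y-pos slot v)
  x∈ : (a ∷ p ++ 1 ∷ b ∷ q) ∈ insertions (a ∷ p ++ b ∷ q)
  x∈ = ∈-insertions⁺ a p b q slot

concatMap-unique : ∀ {A B : Set} (f : A → List B) {xs} → Unique xs → (∀ {x} → x ∈ xs → Unique (f x)) →
  (∀ {x x′ z} → x ∈ xs → x′ ∈ xs → z ∈ f x → z ∈ f x′ → x ≡ x′) → Unique (concatMap f xs)
concatMap-unique f {[]} _ _ _ = []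
concatMap-unique f {x ∷ xs} (x∉xs ∷ xs-unique) f-unique f-injective =
  Unique.++⁺ (f-unique (here refl))
             (concatMap-unique f xs-unique (f-unique ∘ there) (λ x∈ x′∈ → f-injective (there x∈) (there x′∈)))
             disjoint
  where
  disjoint : ∀ {z} → ¬ (z ∈ f x × z ∈ concatMap f xs)
  disjoint (z∈fx , z∈rest) with x′ , x′∈ , z∈fx′ ← ∈-concatMap⁻′ f xs z∈rest =
    All.lookup x∉xs x′∈ (f-injective (here refl) (there x′∈) z∈fx z∈fx′)

first-insertion-new : ∀ e b r → 2 ≤ b → ∀ {z} → z ∈ map (e ∷_) (descentInsertions b r) → e ∷ 1 ∷ b ∷ r ≢ z
first-insertion-new e b r 2≤b z∈ eq
  with z′ , z′∈ , refl ← ∈-map⁻ (e ∷_) z∈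
  with _ , _ , _ , _ , refl , _ ← ∈-descentInsertions⁻ b r z′∈
  = <⇒≢ 2≤b (∷-injectiveˡ (∷-injectiveʳ eq))

descentInsertions-unique : ∀ e r → All (2 ≤_) r → Unique (descentInsertions e r)
descentInsertions-unique e [] [] = []
descentInsertions-unique e (b ∷ r) (2≤b ∷ r≥2) with b ≤ᵇ e
... | true =
  All.tabulate (first-insertion-new e b r 2≤b) ∷ Unique.map⁺ ∷-injectiveʳ (descentInsertions-unique b r r≥2)
... | false = Unique.map⁺ ∷-injectiveʳ (descentInsertions-unique b r r≥2)

insertions-unique : ∀ w → All (2 ≤_) w → Unique (insertions w)
insertions-unique [] _ = []
insertions-unique (a ∷ []) _ = []
insertions-unique (a ∷ b ∷ r) (_ ∷ 2≤b ∷ r≥2) =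
  All.tabulate (first-insertion-new a b r 2≤b) ∷ Unique.map⁺ ∷-injectiveʳ (descentInsertions-unique b r r≥2)

++-1∷-injective : ∀ P Q P′ Q′ → All (2 ≤_) P → All (2 ≤_) P′ → P ++ 1 ∷ Q ≡ P′ ++ 1 ∷ Q′ → P ++ Q ≡ P′ ++ Q′
++-1∷-injective [] Q [] Q′ _ _ refl = refl
++-1∷-injective [] Q (c ∷ P′) Q′ _ (2≤c ∷ _) eq = ⊥-elim (<⇒≢ 2≤c (∷-injectiveˡ eq))
++-1∷-injective (c ∷ P) Q [] Q′ (2≤c ∷ _) _ eq = ⊥-elim (<⇒≢ 2≤c (sym (∷-injectiveˡ eq)))
++-1∷-injective (c ∷ P) Q (c′ ∷ P′) Q′ (_ ∷ P≥2) (_ ∷ P′≥2) eq =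
  cong₂ _∷_ (∷-injectiveˡ eq) (++-1∷-injective P Q P′ Q′ P≥2 P′≥2 (∷-injectiveʳ eq))

insertions-injective : ∀ {y y′ z} → All (1 ≤_) y → All (1 ≤_) y′ →
  z ∈ insertions (map suc y) → z ∈ insertions (map suc y′) → y ≡ y′
insertions-injective {y} {y′} y-pos y′-pos z∈ z∈′
  with a , p , b , q , shift , refl , slot ← ∈-insertions⁻ (map suc y) z∈
  with a′ , p′ , b′ , q′ , shift′ , same-z , slot′ ← ∈-insertions⁻ (map suc y′) z∈′
  = map-injective suc-injective
      (trans shift (trans (++-1∷-injective (a ∷ p) (b ∷ q) (a′ ∷ p′) (b′ ∷ q′)
                                           (AllP.++⁻ˡ (a ∷ p) (Insertion.w≥2 shift y-pos slot))
                                           (AllP.++⁻ˡ (a′ ∷ p′) (Insertion.w≥2 shift′ y′-pos slot′))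
                                           same-z)
                          (sym shift′)))

∷ʳ1≢++ : ∀ u P {b q} → All (2 ≤_) (b ∷ q) → u ∷ʳ 1 ≢ P ++ b ∷ q
∷ʳ1≢++ u [] bq≥2 eq = n≮n 1 (All.head (AllP.++⁻ʳ u (subst (All (2 ≤_)) (sym eq) bq≥2)))
∷ʳ1≢++ [] (c ∷ P) {b} {q} _ eq with ++-conicalʳ P (b ∷ q) (sym (∷-injectiveʳ eq))
... | ()
∷ʳ1≢++ (d ∷ u) (c ∷ P) bq≥2 eq = ∷ʳ1≢++ u P bq≥2 (∷-injectiveʳ eq)

generated-unique : ∀ n m → Unique (generated n m)
generated-unique zero m = []
generated-unique (suc zero) zero = []
generated-unique (suc zero) (suc zero) = [] ∷ []
generated-unique (suc zero) (suc (suc m)) = []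
generated-unique (suc (suc n)) zero = []
generated-unique (suc (suc n)) (suc m) =
  Unique.++⁺ (Unique.map⁺ (∷ʳ-injectiveˡ _ _) (generated-unique (suc n) (suc m)))
             (concatMap-unique (λ y → insertions (map suc y)) (generated-unique (suc n) m)
                               (λ {y} y∈ → insertions-unique (map suc y) (AllP.map⁺ (All.map s≤s (positive y∈))))
                               (λ y∈ y′∈ → insertions-injective (positive y∈) (positive y′∈)))
             disjoint
  where
  positive : ∀ {y} → y ∈ generated (suc n) m → All (1 ≤_) y
  positive y∈ = Valid.positive (generated-sound (suc n) m y∈)
  disjoint : ∀ {v} → ¬ (v ∈ map (_∷ʳ 1) (generated (suc n) (suc m)) ×
                        v ∈ concatMap (λ y → insertions (map suc y)) (generated (suc n) m))
  disjoint (v∈appended , v∈inserted)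
    with y′ , _ , refl ← ∈-map⁻ (_∷ʳ 1) v∈appended
    with y , y∈ , v∈ys ← ∈-concatMap⁻′ (λ y → insertions (map suc y)) (generated (suc n) m) v∈inserted
    with a , p , b , q , shift , same-v , slot ← ∈-insertions⁻ (map suc y) v∈ys
    = ∷ʳ1≢++ y′ ((a ∷ p) ∷ʳ 1) (AllP.++⁻ʳ (a ∷ p) (Insertion.w≥2 shift (positive y∈) slot))
             (trans same-v (sym (++-assoc (a ∷ p) [ 1 ] (b ∷ q))))

-- Counting

weakDescentsAfter : ℕ → List ℕ → ℕ
weakDescentsAfter e [] = 0
weakDescentsAfter e (b ∷ r) = (if b ≤ᵇ e then 1 else 0) + weakDescentsAfter b r

admissibleGaps : List ℕ → ℕ
admissibleGaps (a ∷ b ∷ r) = suc (weakDescentsAfter b r)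
admissibleGaps _ = 0

length-descentInsertions : ∀ e r → length (descentInsertions e r) ≡ weakDescentsAfter e r
length-descentInsertions e [] = refl
length-descentInsertions e (b ∷ r) with b ≤ᵇ e
... | true = cong suc (trans (length-map (e ∷_) (descentInsertions b r)) (length-descentInsertions b r))
... | false = trans (length-map (e ∷_) (descentInsertions b r)) (length-descentInsertions b r)

length-insertions : ∀ w → length (insertions w) ≡ admissibleGaps w
length-insertions [] = refl
length-insertions (a ∷ []) = refl
length-insertions (a ∷ b ∷ r) =
  cong suc (trans (length-map (a ∷_) (descentInsertions b r)) (length-descentInsertions b r))

weakDescentsAfter-∷ʳ1 : ∀ e r → 1 ≤ e → All (1 ≤_) r → weakDescentsAfter e (r ∷ʳ 1) ≡ suc (weakDescentsAfter e r)
weakDescentsAfter-∷ʳ1 (suc e) [] _ [] = refl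
weakDescentsAfter-∷ʳ1 e (b ∷ r) _ (1≤b ∷ r-pos) =
  trans (cong (λ t → (if b ≤ᵇ e then 1 else 0) + t) (weakDescentsAfter-∷ʳ1 b r 1≤b r-pos))
        (+-suc (if b ≤ᵇ e then 1 else 0) (weakDescentsAfter b r))

admissibleGaps-∷ʳ1 : ∀ a y → All (1 ≤_) (a ∷ y) → admissibleGaps ((a ∷ y) ∷ʳ 1) ≡ suc (admissibleGaps (a ∷ y))
admissibleGaps-∷ʳ1 a [] _ = refl
admissibleGaps-∷ʳ1 a (b ∷ r) (_ ∷ 1≤b ∷ r-pos) = cong suc (weakDescentsAfter-∷ʳ1 b r 1≤b r-pos)

weakDescentsAfter-map-suc : ∀ e r → weakDescentsAfter (suc e) (map suc r) ≡ weakDescentsAfter e r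
weakDescentsAfter-map-suc e [] = refl
weakDescentsAfter-map-suc e (zero ∷ r) = cong suc (weakDescentsAfter-map-suc zero r)
weakDescentsAfter-map-suc e (suc b ∷ r) =
  cong (λ t → (if b <ᵇ e then 1 else 0) + t) (weakDescentsAfter-map-suc (suc b) r)

admissibleGaps-map-suc : ∀ y → admissibleGaps (map suc y) ≡ admissibleGaps y
admissibleGaps-map-suc [] = refl
admissibleGaps-map-suc (a ∷ []) = refl
admissibleGaps-map-suc (a ∷ b ∷ r) = cong suc (weakDescentsAfter-map-suc b r)

weakDescentsAfter-insert : ∀ c p b q → 1 ≤ c → All (2 ≤_) p → 2 ≤ b → b ≤Last (c ∷ p) →
  weakDescentsAfter c (p ++ 1 ∷ b ∷ q) ≡ weakDescentsAfter c (p ++ b ∷ q)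
weakDescentsAfter-insert c@(suc _) [] b@(suc (suc _)) q _ [] _ (single b≤c)
  rewrite T⇒≡true (≤⇒≤ᵇ b≤c) = refl
weakDescentsAfter-insert (suc _) [] (suc zero) q _ [] (s≤s ()) _
weakDescentsAfter-insert c (d ∷ p) b q _ (2≤d ∷ p≥2) 2≤b (_ ∷ slot) =
  cong (λ t → (if d ≤ᵇ c then 1 else 0) + t) (weakDescentsAfter-insert d p b q (2≤⇒1≤ 2≤d) p≥2 2≤b slot)

admissibleGaps-insert : ∀ a p b q → All (2 ≤_) (a ∷ p ++ b ∷ q) → b ≤Last p →
  admissibleGaps (a ∷ p ++ 1 ∷ b ∷ q) ≡ admissibleGaps (a ∷ p ++ b ∷ q)
admissibleGaps-insert a [] (suc (suc _)) q _ [] = refl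
admissibleGaps-insert a [] (suc zero) q (_ ∷ s≤s () ∷ _) []
admissibleGaps-insert a [] zero q (_ ∷ () ∷ _) []
admissibleGaps-insert a (c ∷ p) b q (_ ∷ w≥2) slot with AllP.++⁻ (c ∷ p) w≥2
... | 2≤c ∷ p≥2 , 2≤b ∷ _ = cong suc (weakDescentsAfter-insert c p b q (2≤⇒1≤ 2≤c) p≥2 2≤b slot)

GeneratedStep-gaps : ∀ {n m x} → (∀ m′ {y} → y ∈ generated (suc n) m′ → admissibleGaps y + m′ ≡ suc n) →
  GeneratedStep n m x → admissibleGaps x + suc m ≡ suc (suc n)
GeneratedStep-gaps {n} {m} gaps-y (appended {y} y∈) with generated-sound (suc n) (suc m) y∈
... | valid length≡ positive _ _ _ _ with y
...   | [] with () ← length≡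
...   | a ∷ ys = trans (cong (_+ suc m) (admissibleGaps-∷ʳ1 a ys positive)) (cong suc (gaps-y (suc m) y∈))
GeneratedStep-gaps {n} {m} gaps-y (inserted {y} {a} {p} {b} {q} y∈ shift slot) = begin
  admissibleGaps (a ∷ p ++ 1 ∷ b ∷ q) + suc m  ≡⟨ +-suc _ m ⟩
  suc (admissibleGaps (a ∷ p ++ 1 ∷ b ∷ q) + m)
    ≡⟨ cong (λ g → suc (g + m)) (trans (admissibleGaps-insert a p b q (Insertion.w≥2 shift y-pos slot) slot)
                                        (trans (cong admissibleGaps (sym shift)) (admissibleGaps-map-suc y))) ⟩
  suc (admissibleGaps y + m)                   ≡⟨ cong suc (gaps-y m y∈) ⟩
  suc (suc n)                                  ∎
  where
  open ≡-Reasoning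
  y-pos : All (1 ≤_) y
  y-pos = Valid.positive (generated-sound (suc n) m y∈)

generated-gaps : ∀ n m {y} → y ∈ generated (suc n) m → admissibleGaps y + m ≡ suc n
generated-gaps zero (suc zero) (here refl) = refl
generated-gaps (suc n) (suc m) y∈ = GeneratedStep-gaps (generated-gaps n) (generated-step n m y∈)

length-concatMap-const : ∀ {A B : Set} (f : A → List B) xs c → (∀ {x} → x ∈ xs → length (f x) ≡ c) →
  length (concatMap f xs) ≡ length xs * c
length-concatMap-const f [] c _ = refl
length-concatMap-const f (x ∷ xs) c length-f =
  trans (length-++ (f x)) (cong₂ _+_ (length-f (here refl)) (length-concatMap-const f xs c (length-f ∘ there)))

length-generated-step : ∀ n m → length (generated (suc (suc n)) (suc m))
  ≡ length (generated (suc n) (suc m)) + length (generated (suc n) m) * (suc n ∸ m)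
length-generated-step n m =
  trans (length-++ (map (_∷ʳ 1) (generated (suc n) (suc m))))
        (cong₂ _+_ (length-map (_∷ʳ 1) (generated (suc n) (suc m)))
                   (length-concatMap-const (λ y → insertions (map suc y)) (generated (suc n) m) (suc n ∸ m) gaps))
  where
  gaps : ∀ {y} → y ∈ generated (suc n) m → length (insertions (map suc y)) ≡ suc n ∸ m
  gaps {y} y∈ = trans (length-insertions (map suc y))
                      (trans (admissibleGaps-map-suc y)
                             (trans (sym (m+n∸n≡m (admissibleGaps y) m)) (cong (_∸ m) (generated-gaps n m y∈))))

generated-above : ∀ n m → suc n < m → generated (suc n) m ≡ []
generated-above n m n<m with generated (suc n) m in eq
... | [] = refl
... | y ∷ _ = ⊥-elim (<⇒≱ n<m (≤-trans (m≤n+m m (admissibleGaps y))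
                                        (≤-reflexive (generated-gaps n m (subst (y ∈_) (sym eq) (here refl))))))

S-above : ∀ n k → n < k → S n k ≡ 0
S-above zero (suc k) _ = refl
S-above (suc n) (suc k) (s≤s n<k) =
  cong₂ _+_ (trans (cong (suc k *_) (S-above n (suc k) (m≤n⇒m≤1+n n<k))) (*-zeroʳ (suc k))) (S-above n k n<k)

length-generated : ∀ n m → m ≤ suc n → length (generated (suc n) m) ≡ S n (suc n ∸ m)
length-generated zero zero _ = refl
length-generated zero (suc zero) _ = refl
length-generated zero (suc (suc m)) (s≤s ())
length-generated (suc n) zero _ = sym (S-above (suc n) (suc (suc n)) ≤-refl)
length-generated (suc n) (suc m) (s≤s m≤1+n) with m≤n⇒m<n∨m≡n m≤1+n
... | inj₂ refl = begin
  length (generated (suc (suc n)) (suc (suc n)))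
    ≡⟨ length-generated-step n (suc n) ⟩
  length (generated (suc n) (suc (suc n))) + length (generated (suc n) (suc n)) * (n ∸ n)
    ≡⟨ cong₂ (λ xs k → length xs + length (generated (suc n) (suc n)) * k)
             (generated-above n (suc (suc n)) ≤-refl) (n∸n≡0 n) ⟩
  length (generated (suc n) (suc n)) * 0
    ≡⟨ *-zeroʳ (length (generated (suc n) (suc n))) ⟩
  S (suc n) 0
    ≡⟨ cong (S (suc n)) (sym (n∸n≡0 n)) ⟩
  S (suc n) (n ∸ n) ∎
  where open ≡-Reasoning
... | inj₁ (s≤s m≤n) = begin
  length (generated (suc (suc n)) (suc m))
    ≡⟨ length-generated-step n m ⟩
  length (generated (suc n) (suc m)) + length (generated (suc n) m) * (suc n ∸ m)
    ≡⟨ cong₂ (λ u v → u + v * (suc n ∸ m)) (length-generated n (suc m) (s≤s m≤n)) (length-generated n m m≤1+n) ⟩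
  S n (n ∸ m) + S n (suc n ∸ m) * (suc n ∸ m)
    ≡⟨ cong (λ k → S n (n ∸ m) + S n k * k) 1+n∸m ⟩
  S n (n ∸ m) + S n (suc (n ∸ m)) * suc (n ∸ m)
    ≡⟨ trans (+-comm (S n (n ∸ m)) _) (cong (_+ S n (n ∸ m)) (*-comm (S n (suc (n ∸ m))) (suc (n ∸ m)))) ⟩
  S (suc n) (suc (n ∸ m))
    ≡⟨ cong (S (suc n)) (sym 1+n∸m) ⟩
  S (suc n) (suc n ∸ m) ∎
  where
  open ≡-Reasoning
  1+n∸m : suc n ∸ m ≡ suc (n ∸ m)
  1+n∸m = +-∸-assoc 1 m≤n

generated-bounded : ∀ n m {x} → x ∈ generated (suc n) m → All (_≤ suc n) x
generated-bounded n m {x} x∈ = All.map (λ c≤max → ≤-trans c≤max max≤n) (≤-maxW x)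
  where
  max≤n : maxW x ≤ suc n
  max≤n = ≤-trans (≤-reflexive (Valid.maxW≡ (generated-sound (suc n) m x∈)))
                  (≤-trans (m≤n+m m (admissibleGaps x)) (≤-reflexive (generated-gaps n m x∈)))

length-Bhat112≡length-generated : ∀ n m → length (Bhat112 (suc n) m) ≡ length (generated (suc n) m)
length-Bhat112≡length-generated n m =
  ↭-length (∼bag⇒↭ (unique∧set⇒bag (Bhat112-unique (suc n) m) (generated-unique (suc n) m) (mk⇔ to from)))
  where
  to : ∀ {x} → x ∈ Bhat112 (suc n) m → x ∈ generated (suc n) m
  to x∈ = generated-complete n m (proj₁ (∈-Bhat112⁻ x∈))
  from : ∀ {x} → x ∈ generated (suc n) m → x ∈ Bhat112 (suc n) m
  from x∈ = ∈-Bhat112⁺ (generated-sound (suc n) m x∈) (generated-bounded n m x∈)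

Sℤ-negative : ∀ n k → 0 < k → Sℤ n (- (+ k)) ≡ 0
Sℤ-negative n (suc k) _ = refl

length-Bhat112 : ∀ n m → length (Bhat112 (suc n) m) ≡ Sℤ n (suc n ⊖ m)
length-Bhat112 n m with m ≤? suc n
... | yes m≤1+n = begin
  length (Bhat112 (suc n) m)     ≡⟨ length-Bhat112≡length-generated n m ⟩
  length (generated (suc n) m)   ≡⟨ length-generated n m m≤1+n ⟩
  S n (suc n ∸ m)                ≡⟨ cong (Sℤ n) (sym (⊖-≥ m≤1+n)) ⟩
  Sℤ n (suc n ⊖ m)               ∎
  where open ≡-Reasoning
... | no m≰1+n = begin
  length (Bhat112 (suc n) m)     ≡⟨ length-Bhat112≡length-generated n m ⟩
  length (generated (suc n) m)   ≡⟨ cong length (generated-above n m 1+n<m) ⟩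
  0                              ≡⟨ sym (Sℤ-negative n (m ∸ suc n) (m<n⇒0<n∸m 1+n<m)) ⟩
  Sℤ n (- (+ (m ∸ suc n)))       ≡⟨ cong (Sℤ n) (sym (⊖-< 1+n<m)) ⟩
  Sℤ n (suc n ⊖ m)               ∎
  where
  open ≡-Reasoning
  1+n<m : suc n < m
  1+n<m = ≰⇒> m≰1+n

sum-zeros : ∀ {A : Set} (xs : List A) → sum (map (λ _ → 0) xs) ≡ 0
sum-zeros [] = refl
sum-zeros (_ ∷ xs) = sum-zeros xs

sum-map-+ : ∀ {A : Set} (f g : A → ℕ) xs → sum (map (λ x → f x + g x) xs) ≡ sum (map f xs) + sum (map g xs)
sum-map-+ f g [] = refl
sum-map-+ f g (x ∷ xs) =
  trans (cong (λ t → (f x + g x) + t) (sum-map-+ f g xs)) (interchange +-commutativeSemigroup (f x) (g x) _ _)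

sum-upTo-snoc : ∀ (h : ℕ → ℕ) N → sum (map h (upTo (suc N))) ≡ sum (map h (upTo N)) + h N
sum-upTo-snoc h N = begin
  sum (map h (upTo (suc N)))         ≡⟨ cong (sum ∘ map h) (sym (upTo-∷ʳ N)) ⟩
  sum (map h (upTo N ∷ʳ N))          ≡⟨ cong sum (map-++ h (upTo N) [ N ]) ⟩
  sum (map h (upTo N) ∷ʳ h N)        ≡⟨ sum-++ (map h (upTo N)) [ h N ] ⟩
  sum (map h (upTo N)) + (h N + 0)   ≡⟨ cong (λ t → sum (map h (upTo N)) + t) (+-identityʳ (h N)) ⟩
  sum (map h (upTo N)) + h N         ∎
  where open ≡-Reasoning

sum-reverse : ∀ (h : ℕ → ℕ) N → sum (map (λ m → h (N ∸ m)) (upTo (suc N))) ≡ sum (map h (upTo (suc N)))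
sum-reverse h zero = refl
sum-reverse h (suc N) = begin
  sum (map (λ m → h (suc N ∸ m)) (upTo (suc (suc N))))  ≡⟨ cong sum (map-upTo-suc (λ m → h (suc N ∸ m)) (suc N)) ⟩
  h (suc N) + sum (map (λ m → h (N ∸ m)) (upTo (suc N))) ≡⟨ cong (λ t → h (suc N) + t) (sum-reverse h N) ⟩
  h (suc N) + sum (map h (upTo (suc N)))                 ≡⟨ +-comm (h (suc N)) _ ⟩
  sum (map h (upTo (suc N))) + h (suc N)                 ≡⟨ sym (sum-upTo-snoc h (suc N)) ⟩
  sum (map h (upTo (suc (suc N))))                       ∎
  where open ≡-Reasoning

sum-indicator : ∀ a K → a ≤ K → sum (map (λ m → if a ≡ᵇ m then 1 else 0) (upTo (suc K))) ≡ 1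
sum-indicator zero K _ =
  trans (cong sum (map-upTo-suc (λ m → if 0 ≡ᵇ m then 1 else 0) K)) (cong suc (sum-zeros (upTo K)))
sum-indicator (suc a) (suc K) (s≤s a≤K) =
  trans (cong sum (map-upTo-suc (λ m → if suc a ≡ᵇ m then 1 else 0) (suc K))) (sum-indicator a K a≤K)

length-filter-∷ : ∀ {A : Set} (f : A → ℕ) m x xs →
  length (filter (λ x → f x ≟ m) (x ∷ xs)) ≡ (if f x ≡ᵇ m then 1 else 0) + length (filter (λ x → f x ≟ m) xs)
length-filter-∷ f m x xs with f x ≡ᵇ m
... | true = refl
... | false = refl

length-partition : ∀ {A : Set} (f : A → ℕ) K xs → All (λ x → f x ≤ K) xs →
  length xs ≡ sum (map (λ m → length (filter (λ x → f x ≟ m) xs)) (upTo (suc K)))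
length-partition f K [] [] = sym (sum-zeros (upTo (suc K)))
length-partition f K (x ∷ xs) (fx≤K ∷ bounded) = sym (begin
  sum (map (λ m → length (filter (λ x → f x ≟ m) (x ∷ xs))) (upTo (suc K)))
    ≡⟨ cong sum (map-cong (λ m → length-filter-∷ f m x xs) (upTo (suc K))) ⟩
  sum (map (λ m → (if f x ≡ᵇ m then 1 else 0) + length (filter (λ x → f x ≟ m) xs)) (upTo (suc K)))
    ≡⟨ sum-map-+ (λ m → if f x ≡ᵇ m then 1 else 0) (λ m → length (filter (λ x → f x ≟ m) xs)) (upTo (suc K)) ⟩
  sum (map (λ m → if f x ≡ᵇ m then 1 else 0) (upTo (suc K)))
    + sum (map (λ m → length (filter (λ x → f x ≟ m) xs)) (upTo (suc K)))
    ≡⟨ cong₂ _+_ (sum-indicator (f x) K fx≤K) (sym (length-partition f K xs bounded)) ⟩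
  suc (length xs) ∎)
  where open ≡-Reasoning

length-Bhat≡Bell : ∀ n → length (Bhat (suc n) σ112) ≡ Bell n
length-Bhat≡Bell n = begin
  length (Bhat (suc n) σ112)
    ≡⟨ length-partition maxW (suc n) (Bhat (suc n) σ112) bounded ⟩
  sum (map (λ m → length (Bhat112 (suc n) m)) (upTo (suc (suc n))))
    ≡⟨ cong sum (map-cong-upTo (suc (suc n)) (λ {m} m<2+n →
         trans (length-Bhat112≡length-generated n m) (length-generated n m (≤-pred m<2+n)))) ⟩
  sum (map (λ m → S n (suc n ∸ m)) (upTo (suc (suc n))))
    ≡⟨ sum-reverse (S n) (suc n) ⟩
  sum (map (S n) (upTo (suc (suc n))))
    ≡⟨ sum-upTo-snoc (S n) (suc n) ⟩
  Bell n + S n (suc n)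
    ≡⟨ cong (λ t → Bell n + t) (S-above n (suc n) ≤-refl) ⟩
  Bell n + 0
    ≡⟨ +-identityʳ (Bell n) ⟩
  Bell n ∎
  where
  open ≡-Reasoning
  bounded : All (λ x → maxW x ≤ suc n) (Bhat (suc n) σ112)
  bounded = All.tabulate (λ {x} x∈ → maxW-≤ x (proj₂ (∈-Bhat⁻ x∈)))

mainTheorem12 : ((n m : ℕ) → n ≥ 1 → m ≥ 1 → length (Bhat112 n m) ≡ Sℤ (n ∸ 1) ((+ n) - (+ m)))
    × ((n : ℕ) → n ≥ 1 → length (Bhat n (1 ∷ 1 ∷ 2 ∷ [])) ≡ Bell (n ∸ 1))
mainTheorem12 = stirling , bell
  where
  stirling : (n m : ℕ) → n ≥ 1 → m ≥ 1 → length (Bhat112 n m) ≡ Sℤ (n ∸ 1) ((+ n) - (+ m))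
  stirling (suc n) m _ _ = trans (length-Bhat112 n m) (cong (Sℤ n) (sym ([+m]-[+n]≡m⊖n (suc n) m)))
  bell : (n : ℕ) → n ≥ 1 → length (Bhat n (1 ∷ 1 ∷ 2 ∷ [])) ≡ Bell (n ∸ 1)
  bell (suc n) _ = length-Bhat≡Bell n
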